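{- Let $\mathbf M_1=(S,\mathcal I_1)$ and $\mathbf M_2=(S,\mathcal I_2)$ be matroids, let $R$ be a maximum-cardinality common independent set, and let $I$ be an inclusion-wise maximal common independent set with $|I|<|R|$. Let $P=(v_1=s,v_2,\dots,v_{2k+1}=t)$ be a directed $s$-$t$ path without shortcuts in $D(R,I)$. Then $P$ has at least four vertices and $I\triangle\{v_2,v_3\}$ is a common independent set of $\mathbf M_1$ and $\mathbf M_2$.
   Context: For matroids $\mathbf N_1=(T,\mathcal J_1)$, $\mathbf N_2=(T,\mathcal J_2)$ and a common independent set $J$, the auxiliary digraph $D_{\mathbf N_1,\mathbf N_2}(J)$ has vertex set $T\cup\{s,t\}$ and arcs: $(e,f)$ for $e\in J$, $f\in T\setminus J$ with $J\cup\{f\}\notin\mathcal J_1$ and $(J\cup\{f\})\setminus\{e\}\in\mathcal J_1$; $(f,e)$ for $e\in J$, $f\in T\setminus J$ with $J\cup\{f\}\notin\mathcal J_2$ and $(J\cup\{f\})\setminus\{e\}\in\mathcal J_2$; $(s,f)$ for $f\in T\setminus J$ with $J\cup\{f\}\in\mathcal J_1$; $(f,t)$ for $f\in T\setminus J$ with $J\cup\{f\}\in\mathcal J_2$. Let $\mathbf M_j(R,I)=(\mathbf M_j|(R\cup I))/(R\cap I)$ (restriction to $R\cup I$, then contraction of $R\cap I$; a matroid on $R\triangle I$, where in the contraction $\mathbf M/X$ a set $Y$ is independent iff the restriction to $X$ has a base $B$ with $Y\cup B$ independent), and $D(R,I)=D_{\mathbf M_1(R,I),\mathbf M_2(R,I)}(I\setminus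 R)$. A directed path $(u_1,\dots,u_m)$ (distinct vertices) is without shortcuts if there is no arc $(u_i,u_j)$ with $j>i+1$. -}

module Defs where

open import Level using (0ℓ)
open import Data.Nat using (ℕ; suc; _*_; _+_; _≤_; _<_)
open import Data.Fin using (Fin; toℕ)
open import Data.Fin.Subset using (Subset; ⊥; ⁅_⁆; _∈_; _∉_; _⊆_; _∩_; _∪_; _─_; ∣_∣)
open import Data.Product using (Σ; ∃; _×_)
open import Data.List using (List; []; _∷_; length; lookup; _++_)
open import Data.List.Relation.Unary.Linked using (Linked)
open import Data.List.Relation.Unary.Unique.Propositional using (Unique)
open import Relation.Nullary using (¬_)
open import Relation.Binary.PropositionalEquality using (_≡_)

Family : ℕ → Set₁
Family n = Subset n → Set

record Matroid (n : ℕ) : Set₁ where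
  field
    Indep     : Family n
    indep-∅   : Indep ⊥
    indep-⊆   : ∀ {X Y} → Y ⊆ X → Indep X → Indep Y
    indep-aug : ∀ {X Y} → Indep X → Indep Y → ∣ X ∣ < ∣ Y ∣ →
                ∃ λ e → e ∈ Y × e ∉ X × Indep (X ∪ ⁅ e ⁆)
open Matroid public

_△_ : ∀ {n} → Subset n → Subset n → Subset n
X △ Y = (X ─ Y) ∪ (Y ─ X)

restrict : ∀ {n} → Family n → Subset n → Family n
restrict 𝓘 E Y = Y ⊆ E × 𝓘 Y

IsBaseOf : ∀ {n} → Family n → Subset n → Subset n → Set
IsBaseOf 𝓕 X B = B ⊆ X × 𝓕 B × (∀ B' → B ⊆ B' → B' ⊆ X → 𝓕 B' → B' ≡ B)

contract : ∀ {n} → Family n → Subset n → Subset n → Family n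
contract 𝓕 E X Y = Y ⊆ (E ─ X) × ∃ λ B → IsBaseOf 𝓕 X B × 𝓕 (Y ∪ B)

M[_,_] : ∀ {n} → Matroid n → Subset n → Subset n → Family n
M[ M , R ] I = contract (restrict (Indep M) (R ∪ I)) (R ∪ I) (R ∩ I)

CommonIndep : ∀ {n} → Matroid n → Matroid n → Subset n → Set
CommonIndep M₁ M₂ X = Indep M₁ X × Indep M₂ X

MaxCardCommonIndep : ∀ {n} → Matroid n → Matroid n → Subset n → Set
MaxCardCommonIndep M₁ M₂ R =
  CommonIndep M₁ M₂ R × (∀ X → CommonIndep M₁ M₂ X → ∣ X ∣ ≤ ∣ R ∣)

InclMaxCommonIndep : ∀ {n} → Matroid n → Matroid n → Subset n → Set
InclMaxCommonIndep M₁ M₂ I =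
  CommonIndep M₁ M₂ I × (∀ X → CommonIndep M₁ M₂ X → I ⊆ X → X ≡ I)

-- vertices of the auxiliary digraph: s, t and elements of the ground set
-- (only elements of T occur as endpoints of arcs)
data Vtx (n : ℕ) : Set where
  s t : Vtx n
  el  : Fin n → Vtx n

data Arc {n} (T : Subset n) (𝓙₁ 𝓙₂ : Family n) (J : Subset n) : Vtx n → Vtx n → Set where
  arc₁ : ∀ {e f} → e ∈ J → f ∈ (T ─ J) →
         ¬ 𝓙₁ (J ∪ ⁅ f ⁆) → 𝓙₁ ((J ∪ ⁅ f ⁆) ─ ⁅ e ⁆) → Arc T 𝓙₁ 𝓙₂ J (el e) (el f)
  arc₂ : ∀ {e f} → e ∈ J → f ∈ (T ─ J) →
         ¬ 𝓙₂ (J ∪ ⁅ f ⁆) → 𝓙₂ ((J ∪ ⁅ f ⁆) ─ ⁅ e ⁆) → Arc T 𝓙₁ 𝓙₂ J (el f) (el e)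
  arc-s : ∀ {f} → f ∈ (T ─ J) → 𝓙₁ (J ∪ ⁅ f ⁆) → Arc T 𝓙₁ 𝓙₂ J s (el f)
  arc-t : ∀ {f} → f ∈ (T ─ J) → 𝓙₂ (J ∪ ⁅ f ⁆) → Arc T 𝓙₁ 𝓙₂ J (el f) t

D[_,_,_,_] : ∀ {n} → Matroid n → Matroid n → Subset n → Subset n → Vtx n → Vtx n → Set
D[ M₁ , M₂ , R , I ] = Arc (R △ I) (M[ M₁ , R ] I) (M[ M₂ , R ] I) (I ─ R)

IsSTPath : ∀ {n} → (Vtx n → Vtx n → Set) → List (Vtx n) → Set
IsSTPath A P = Unique P × Linked A P × (∃ λ Q → P ≡ s ∷ Q) × (∃ λ Q → P ≡ Q ++ (t ∷ []))

NoShortcuts : ∀ {n} → (Vtx n → Vtx n → Set) → List (Vtx n) → Set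
NoShortcuts A P = ∀ (i j : Fin (length P)) → suc (toℕ i) < toℕ j → ¬ A (lookup P i) (lookup P j)

{-# OPTIONS --safe #-}
-- The first arc (s, f) of the path says that f can be added to I in M₁(R, I).
-- If the second arc went to t, f could also be added in M₂(R, I), and I ∪ {f}
-- would be a larger common independent set, contradicting the maximality of I.
-- Since f ∉ I ─ R the second arc cannot be of the first kind either, so it is
-- an exchange arc (f, e): then (I ∪ {f}) ─ {e} = I △ {f, e} is independent in
-- M₂(R, I) and, being a subset of I ∪ {f}, also in M₁(R, I). Independence in
-- M(R, I) transfers back to M because R ∩ I is independent. Only the
-- maximality of I is used: neither R being of maximum cardinality, nor the
-- parity of the path length, nor the absence of shortcuts plays a role.
module Submission where

open import Defs
open import Data.Nat using (ℕ; suc; _*_; _≤_; _<_)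
open import Data.Nat.Properties using (m≤m+n)
open import Data.Fin.Subset
  using (Subset; ⁅_⁆; _∪_; ∣_∣; _∈_; _∉_; _⊆_; _∩_; _─_; outside)
open import Data.Fin.Subset.Properties
  using (_∈?_; x∈p∪q⁺; x∈p∪q⁻; x∈p∩q⁺; p⊆p∪q; q⊆p∪q; p∩q⊆p; p∩q⊆q;
         x∈p∧x∉q⇒x∈p─q; p─q⊆p; x∈⁅x⁆; x∈⁅y⁆⇒x≡y)
open import Data.Product using (∃; _×_; _,_)
open import Data.Sum using (inj₁; inj₂)
open import Data.Maybe using (just)
open import Data.List using (List; []; _∷_; length; _++_; last)
open import Data.List.Relation.Unary.Linked using (Linked; [-]; _∷_)
open import Data.Vec using (here; there; _∷_)
open import Data.Empty using (⊥-elim)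
open import Function using (_∘_)
open import Relation.Nullary using (yes; no)
open import Relation.Binary.PropositionalEquality using (_≡_; refl; cong; trans; subst; sym)

private
  variable
    n : ℕ

x∈p─q⇒x∉q : ∀ {p q : Subset n} {x} → x ∈ p ─ q → x ∉ q
x∈p─q⇒x∉q {p = _ ∷ p} {outside ∷ q} here      ()
x∈p─q⇒x∉q {p = _ ∷ p} {_ ∷ q}       (there m) (there m') = x∈p─q⇒x∉q m m'

x∈p△q─[q─p]⇒x∉q : ∀ {p q : Subset n} {x} → x ∈ (p △ q) ─ (q ─ p) → x ∉ q
x∈p△q─[q─p]⇒x∉q {p = p} {q} x∈ x∈q with x∈p∪q⁻ (p ─ q) (q ─ p) (p─q⊆p _ _ x∈)
... | inj₁ x∈p─q = x∈p─q⇒x∉q x∈p─q x∈q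
... | inj₂ x∈q─p = x∈p─q⇒x∉q x∈ x∈q─p

y∈p⇒⁅y⁆⊆p : ∀ {p : Subset n} {y} → y ∈ p → ⁅ y ⁆ ⊆ p
y∈p⇒⁅y⁆⊆p {p = p} {y} y∈p x∈y = subst (_∈ p) (sym (x∈⁅y⁆⇒x≡y y x∈y)) y∈p

q⊆q─p∪p∩q : ∀ (p q : Subset n) → q ⊆ (q ─ p) ∪ (p ∩ q)
q⊆q─p∪p∩q p q {x} x∈q with x ∈? p
... | yes x∈p = q⊆p∪q _ _ (x∈p∩q⁺ (x∈p , x∈q))
... | no  x∉p = p⊆p∪q _ (x∈p∧x∉q⇒x∈p─q x∈q x∉p)

p△[q∪r]⊆p∪q : ∀ (p q r : Subset n) → r ⊆ p → p △ (q ∪ r) ⊆ p ∪ q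
p△[q∪r]⊆p∪q p q r r⊆p x∈ with x∈p∪q⁻ (p ─ (q ∪ r)) ((q ∪ r) ─ p) x∈
... | inj₁ x∈p─q∪r = p⊆p∪q _ (p─q⊆p _ _ x∈p─q∪r)
... | inj₂ x∈q∪r─p with x∈p∪q⁻ q r (p─q⊆p _ _ x∈q∪r─p)
...   | inj₁ x∈q = q⊆p∪q _ _ x∈q
...   | inj₂ x∈r = ⊥-elim (x∈p─q⇒x∉q x∈q∪r─p (r⊆p x∈r))

module _ (R I : Subset n) where

  I∪⁅f⁆⊆[I─R∪⁅f⁆]∪R∩I : ∀ f → I ∪ ⁅ f ⁆ ⊆ ((I ─ R) ∪ ⁅ f ⁆) ∪ (R ∩ I)
  I∪⁅f⁆⊆[I─R∪⁅f⁆]∪R∩I f x∈ with x∈p∪q⁻ I ⁅ f ⁆ x∈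
  ... | inj₂ x∈f = p⊆p∪q _ (q⊆p∪q _ _ x∈f)
  ... | inj₁ x∈I with x∈p∪q⁻ (I ─ R) (R ∩ I) (q⊆q─p∪p∩q R I x∈I)
  ...   | inj₁ x∈I─R = p⊆p∪q _ (p⊆p∪q _ x∈I─R)
  ...   | inj₂ x∈R∩I = q⊆p∪q _ _ x∈R∩I

  I△⁅f,e⁆⊆[I─R∪⁅f⁆─⁅e⁆]∪R∩I : ∀ f {e} → e ∈ I →
    I △ (⁅ f ⁆ ∪ ⁅ e ⁆) ⊆ (((I ─ R) ∪ ⁅ f ⁆) ─ ⁅ e ⁆) ∪ (R ∩ I)
  I△⁅f,e⁆⊆[I─R∪⁅f⁆─⁅e⁆]∪R∩I f {e} e∈I x∈
    with x∈p∪q⁻ (I ─ (⁅ f ⁆ ∪ ⁅ e ⁆)) ((⁅ f ⁆ ∪ ⁅ e ⁆) ─ I) x∈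
  ... | inj₁ x∈I─fe with x∈p∪q⁻ (I ─ R) (R ∩ I) (q⊆q─p∪p∩q R I (p─q⊆p _ _ x∈I─fe))
  ...   | inj₁ x∈I─R = p⊆p∪q _ (x∈p∧x∉q⇒x∈p─q (p⊆p∪q _ x∈I─R)
                                  (x∈p─q⇒x∉q x∈I─fe ∘ q⊆p∪q _ _))
  ...   | inj₂ x∈R∩I = q⊆p∪q _ _ x∈R∩I
  I△⁅f,e⁆⊆[I─R∪⁅f⁆─⁅e⁆]∪R∩I f {e} e∈I x∈ | inj₂ x∈fe─I
    with x∈p∪q⁻ ⁅ f ⁆ ⁅ e ⁆ (p─q⊆p _ _ x∈fe─I)
  ... | inj₁ x∈f = p⊆p∪q _ (x∈p∧x∉q⇒x∈p─q (q⊆p∪q _ _ x∈f) (x∈p─q⇒x∉q x∈fe─I ∘ y∈p⇒⁅y⁆⊆p e∈I))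
  ... | inj₂ x∈e = ⊥-elim (x∈p─q⇒x∉q x∈fe─I (y∈p⇒⁅y⁆⊆p e∈I x∈e))

-- R ∩ I is independent, so it is its own (unique) base in the contraction.
M[R,I]-indep⇒indep : ∀ (M : Matroid n) R I {Y} → Indep M I →
  M[ M , R ] I Y → Indep M (Y ∪ (R ∩ I))
M[R,I]-indep⇒indep M R I indI (_ , B , (B⊆R∩I , _ , maximal) , (_ , indY∪B)) =
  subst (λ Z → Indep M (_ ∪ Z)) (sym R∩I≡B) indY∪B
  where
  R∩I≡B : R ∩ I ≡ B
  R∩I≡B = maximal (R ∩ I) B⊆R∩I (λ x∈ → x∈)
            ( p⊆p∪q _ ∘ p∩q⊆p R I
            , indep-⊆ M (p∩q⊆q R I) indI)

augment-indep : ∀ (M : Matroid n) R I {f} → Indep M I →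
  M[ M , R ] I ((I ─ R) ∪ ⁅ f ⁆) → Indep M (I ∪ ⁅ f ⁆)
augment-indep M R I {f} indI ind =
  indep-⊆ M (I∪⁅f⁆⊆[I─R∪⁅f⁆]∪R∩I R I f) (M[R,I]-indep⇒indep M R I indI ind)

exchange-indep : ∀ (M : Matroid n) R I {f e} → Indep M I → e ∈ I →
  M[ M , R ] I (((I ─ R) ∪ ⁅ f ⁆) ─ ⁅ e ⁆) → Indep M (I △ (⁅ f ⁆ ∪ ⁅ e ⁆))
exchange-indep M R I {f} indI e∈I ind =
  indep-⊆ M (I△⁅f,e⁆⊆[I─R∪⁅f⁆─⁅e⁆]∪R∩I R I f e∈I) (M[R,I]-indep⇒indep M R I indI ind)

InclMaxCommonIndep-augment⇒∈ : ∀ {M₁ M₂ : Matroid n} {I f} →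
  InclMaxCommonIndep M₁ M₂ I → CommonIndep M₁ M₂ (I ∪ ⁅ f ⁆) → f ∈ I
InclMaxCommonIndep-augment⇒∈ {I = I} {f} (_ , maximal) ind =
  subst (f ∈_) (maximal _ ind (p⊆p∪q _)) (q⊆p∪q I _ (x∈⁅x⁆ f))

last-∷ʳ : ∀ {A : Set} (xs : List A) x → last (xs ++ x ∷ []) ≡ just x
last-∷ʳ []           x = refl
last-∷ʳ (_ ∷ [])     x = refl
last-∷ʳ (_ ∷ _ ∷ xs) x = last-∷ʳ (_ ∷ xs) x

data STPathStart (T : Subset n) (𝓙₁ 𝓙₂ : Family n) (J : Subset n) : List (Vtx n) → Set where
  s-f-t : ∀ {f Q} → f ∈ T ─ J → 𝓙₁ (J ∪ ⁅ f ⁆) → 𝓙₂ (J ∪ ⁅ f ⁆) →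
          STPathStart T 𝓙₁ 𝓙₂ J (s ∷ el f ∷ t ∷ Q)
  s-f-e : ∀ {f e u Q} → f ∈ T ─ J → e ∈ J → 𝓙₁ (J ∪ ⁅ f ⁆) → 𝓙₂ ((J ∪ ⁅ f ⁆) ─ ⁅ e ⁆) →
          STPathStart T 𝓙₁ 𝓙₂ J (s ∷ el f ∷ el e ∷ u ∷ Q)

stPathStart : ∀ {T : Subset n} {𝓙₁ 𝓙₂ J} {P : List (Vtx n)} →
  Linked (Arc T 𝓙₁ 𝓙₂ J) (s ∷ P) → last (s ∷ P) ≡ just t → STPathStart T 𝓙₁ 𝓙₂ J (s ∷ P)
stPathStart [-]                               ()
stPathStart (arc-s _ _ ∷ [-])                 ()
stPathStart (arc-s f∈T─J i₁ ∷ arc-t _ i₂ ∷ _) _  = s-f-t f∈T─J i₁ i₂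
stPathStart (arc-s f∈T─J _ ∷ arc₁ f∈J _ _ _ ∷ _) _ = ⊥-elim (x∈p─q⇒x∉q f∈T─J f∈J)
stPathStart (arc-s _ _ ∷ arc₂ _ _ _ _ ∷ [-])  ()
stPathStart (arc-s f∈T─J i₁ ∷ arc₂ e∈J _ _ i₂ ∷ _ ∷ _) _ = s-f-e f∈T─J e∈J i₁ i₂

lemma2 : ∀ {n} (M₁ M₂ : Matroid n) (R I : Subset n) →
    MaxCardCommonIndep M₁ M₂ R → InclMaxCommonIndep M₁ M₂ I → ∣ I ∣ < ∣ R ∣ →
    (k : ℕ) (P : List (Vtx n)) → length P ≡ suc (2 * k) →
    IsSTPath D[ M₁ , M₂ , R , I ] P → NoShortcuts D[ M₁ , M₂ , R , I ] P →
    4 ≤ length P ×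
    (∃ λ v₂ → ∃ λ v₃ → ∃ λ Q → P ≡ s ∷ el v₂ ∷ el v₃ ∷ Q ×
      CommonIndep M₁ M₂ (I △ (⁅ v₂ ⁆ ∪ ⁅ v₃ ⁆)))
lemma2 M₁ M₂ R I _ inclMax@((indI₁ , indI₂) , _) _ _ _ _
       (_ , arcs , (_ , refl) , (Q , P≡Q∷ʳt)) _
  with stPathStart arcs (trans (cong last P≡Q∷ʳt) (last-∷ʳ Q t))
... | s-f-t f∈T─J i₁ i₂ =
  ⊥-elim (x∈p△q─[q─p]⇒x∉q f∈T─J (InclMaxCommonIndep-augment⇒∈ {M₁ = M₁} {M₂} inclMax
           (augment-indep M₁ R I indI₁ i₁ , augment-indep M₂ R I indI₂ i₂)))
... | s-f-e {f} {e} {u} {Q′} _ e∈I─R i₁ i₂ =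
  m≤m+n 4 (length Q′) ,
  (f , e , u ∷ Q′ , refl ,
   ( indep-⊆ M₁ (p△[q∪r]⊆p∪q I ⁅ f ⁆ ⁅ e ⁆ (y∈p⇒⁅y⁆⊆p e∈I)) (augment-indep M₁ R I indI₁ i₁)
   , exchange-indep M₂ R I indI₂ e∈I i₂))
  where
  e∈I : e ∈ I
  e∈I = p─q⊆p I R e∈I─R
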